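{- Let $G$ be a graph with girth $g(G)\geq 5$ and $G\not\cong P_2$. Let $S\subseteq V(G)$ be any metric-locating-dominating set of $G$. For each $u\in S$, let $\overline{u}$ be the neighbor of $u$ of degree $1$ lying in $V(G)\setminus S$ if such a neighbor exists (there is at most one), and $\overline{u}=u$ otherwise. Then $\overline{S}=\{\overline{u}:u\in S\}$ is a doubly resolving set of $G$. Consequently, $\psi(G)\leq\gamma_M(G)$, and this bound is tight, i.e., there exist graphs $G$ with $g(G)\geq 5$ and $\psi(G)=\gamma_M(G)$.
   Context: All graphs are finite, simple, undirected and connected, with at least $2$ vertices; $d(u,v)$ is the length of a shortest $u$-$v$ path. The girth $g(G)$ is the length of a shortest cycle of $G$ (infinite if $G$ is acyclic). A set $S\subseteq V(G)$ is a resolving set if for every two distinct vertices $x,y$ there is $u\in S$ with $d(u,x)\neq d(u,y)$; it is a dominating set if every vertex not in $S$ has a neighbor in $S$; it is a metric-locating-dominating set if it is both resolving and dominating, and $\gamma_M(G)$ is the minimum size of such a set. Two vertices $u,v$ doubly resolve a pair $\{x,y\}$ if $d(u,x)-d(u,y)\neq d(v,x)-d(v,y)$; $S$ is a doubly resolving set if every pair of distinct vertices of $G$ is doubly resolved by some two vertices of $S$; $\psi(G)$ is the minimum size of a doubly resolving set. -}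

module Defs where

open import Data.Nat using (ℕ; zero; suc; _≤_)
open import Data.Integer as ℤ using (ℤ; +_)
open import Data.Fin using (Fin; zero; suc; inject₁; fromℕ; _≟_)
open import Data.Fin.Subset using (Subset; _∈_; _∉_; ∣_∣)
open import Data.Vec using (tabulate)
open import Data.Bool using (Bool; true; false; not)
open import Data.Product using (Σ; ∃; _×_; _,_)
open import Data.Sum using (_⊎_)
open import Relation.Nullary using (¬_; does)
open import Relation.Binary.PropositionalEquality using (_≡_; _≢_; refl)

record Graph (n : ℕ) : Set where
  field
    adj     : Fin n → Fin n → Bool
    adj-sym : ∀ u v → adj u v ≡ adj v u
    irrefl  : ∀ u → adj u u ≡ false
open Graph public

module _ {n : ℕ} (G : Graph n) where

  Edge : Fin n → Fin n → Set
  Edge u v = adj G u v ≡ true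

  nbhd : Fin n → Subset n
  nbhd u = tabulate (adj G u)

  deg : Fin n → ℕ
  deg u = ∣ nbhd u ∣

  data Walk : Fin n → Fin n → ℕ → Set where
    nil  : ∀ {u} → Walk u u 0
    cons : ∀ {u w v k} → Edge u w → Walk w v k → Walk u v (suc k)

  Connected : Set
  Connected = ∀ u v → ∃ λ k → Walk u v k

  Dist : Fin n → Fin n → ℕ → Set
  Dist u v k = Walk u v k × (∀ m → Walk u v m → k ≤ m)

  IsCycle : (m : ℕ) → (Fin (suc m) → Fin n) → Set
  IsCycle m f =
    (3 ≤ suc m) ×
    (∀ i j → f i ≡ f j → i ≡ j) ×
    (∀ (i : Fin m) → Edge (f (inject₁ i)) (f (suc i))) ×
    Edge (f (fromℕ m)) (f zero)

  -- girth ≥ 5 : every cycle has length ≥ 5 (vacuous if acyclic, girth = ∞)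
  GirthAtLeast5 : Set
  GirthAtLeast5 = ∀ m f → IsCycle m f → 5 ≤ suc m

  Resolving : (Fin n → Set) → Set
  Resolving S = ∀ x y → x ≢ y →
    ∃ λ u → S u × ∃ λ a → ∃ λ b → Dist u x a × Dist u y b × a ≢ b

  Dominating : (Fin n → Set) → Set
  Dominating S = ∀ x → ¬ S x → ∃ λ u → S u × Edge x u

  MetricLocatingDominating : (Fin n → Set) → Set
  MetricLocatingDominating S = Resolving S × Dominating S

  DoublyResolves : Fin n → Fin n → Fin n → Fin n → Set
  DoublyResolves u v x y =
    ∃ λ a → ∃ λ b → ∃ λ c → ∃ λ d →
      Dist u x a × Dist u y b × Dist v x c × Dist v y d ×
      ((+ a) ℤ.- (+ b) ≢ (+ c) ℤ.- (+ d))

  DoublyResolving : (Fin n → Set) → Set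
  DoublyResolving S = ∀ x y → x ≢ y →
    ∃ λ u → ∃ λ v → S u × S v × DoublyResolves u v x y

  IsPsi : ℕ → Set
  IsPsi k = (∃ λ (T : Subset n) → DoublyResolving (_∈ T) × ∣ T ∣ ≡ k) ×
            (∀ (T : Subset n) → DoublyResolving (_∈ T) → k ≤ ∣ T ∣)

  IsGammaM : ℕ → Set
  IsGammaM k = (∃ λ (T : Subset n) → MetricLocatingDominating (_∈ T) × ∣ T ∣ ≡ k) ×
               (∀ (T : Subset n) → MetricLocatingDominating (_∈ T) → k ≤ ∣ T ∣)

  -- ū for u ∈ S: BarOf S u w means w = ū
  BarOf : Subset n → Fin n → Fin n → Set
  BarOf S u w =
    (Edge u w × w ∉ S × deg w ≡ 1) ⊎
    (w ≡ u × (∀ z → Edge u z → z ∉ S → deg z ≢ 1))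

  SBar : Subset n → Fin n → Set
  SBar S w = ∃ λ u → u ∈ S × BarOf S u w

Iso : {n m : ℕ} → Graph n → Graph m → Set
Iso {n} {m} G H =
  Σ (Fin n → Fin m) λ f → Σ (Fin m → Fin n) λ g →
    (∀ x → g (f x) ≡ x) × (∀ y → f (g y) ≡ y) ×
    (∀ u v → adj G u v ≡ adj H (f u) (f v))

P2 : Graph 2
P2 = record { adj = λ i j → not (does (i ≟ j)) ; adj-sym = s ; irrefl = r }
  where
  s : ∀ u v → not (does (u ≟ v)) ≡ not (does (v ≟ u))
  s zero zero = refl
  s zero (suc zero) = refl
  s (suc zero) zero = refl
  s (suc zero) (suc zero) = refl
  r : ∀ u → not (does (u ≟ u)) ≡ false
  r zero = refl
  r (suc zero) = refl

IsGraph : {n : ℕ} → Graph n → Set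
IsGraph {n} G = (2 ≤ n) × Connected G

-- If some q ∈ S̄ is nearer to y than to x while some s ∈ S̄ is not, then q and s
-- doubly resolve {x, y}.  S̄ still resolves G, since replacing u ∈ S by its pendant
-- neighbour ū shifts every distance from u by one; so it suffices that S̄ is never
-- entirely nearer to y than to x.  A case analysis on whether x ∈ S, using domination
-- and the absence of 3- and 4-cycles, shows that this would force G ≅ P₂.  As u ↦ ū is
-- injective on S, |S̄| ≤ |S|, whence ψ ≤ γ_M; the path P₃ has ψ = γ_M = 2.
module Submission where

open import Defs
open import Data.Bool using (Bool; true; false; _∨_)
open import Data.Bool.Properties using (∨-comm; T-≡) renaming (_≟_ to _≟ᵇ_)
open import Data.Empty using (⊥; ⊥-elim)
open import Data.Fin using (Fin; zero; suc; inject₁; toℕ; _≟_)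
import Data.Fin.Properties as Finₚ
open import Data.Fin.Subset using (Subset; _∈_; _∉_; ∣_∣; _-_; ⁅_⁆; inside; outside)
open import Data.Fin.Subset.Properties
  using (_∈?_; ∣⁅x⁆∣≡1; x∈⁅y⁆⇒x≡y; x∈⁅x⁆; p⊆q⇒∣p∣≤∣q∣; x∈p∧x≢y⇒x∈p-y; x∈p⇒∣p-x∣<∣p∣)
open import Data.Integer as ℤ using (+_)
import Data.Integer.Properties as ℤₚ
open import Data.Integer.Tactic.RingSolver using (solve-∀)
open import Data.Nat as ℕ using (ℕ; zero; suc; _+_; _≤_; _<_; z≤n; s≤s; _≤?_)
open import Data.Nat.Properties
  using (≤-trans; ≤-antisym; <-cmp; n≮0; n≮n; n≤1+n; <⇒≢; ≰⇒>;
         m<1+n⇒m≤n; +-mono-<-≤; suc-injective; n<1⇒n≡0; n≤0⇒n≡0; n≢0⇒n>0; ≤-reflexive; ≤-pred)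
open import Data.Product using (∃; _×_; _,_; proj₁; proj₂)
open import Data.Sum using (_⊎_; inj₁; inj₂; [_,_]′)
open import Data.Vec using ([]; _∷_; tabulate)
open import Data.Vec.Base using (here; there)
open import Data.Vec.Properties using (lookup⇒[]=; []=⇒lookup; lookup∘tabulate)
open import Function using (_∘_; Equivalence)
open import Relation.Binary.Definitions using (tri<; tri≈; tri>)
open import Relation.Binary.PropositionalEquality
open import Relation.Nullary using (¬_; Dec; yes; no; isYes; contradiction)
open import Relation.Nullary.Decidable using (_×-dec_; _⊎-dec_; _→-dec_; ¬?; toWitness; fromWitness)

least-witness : (P : ℕ → Set) → (∀ i → Dec (P i)) →
                ∀ k → P k → ∃ λ m → P m × (∀ i → P i → m ≤ i)
least-witness P P? k pk with P? 0
... | yes p0 = 0 , p0 , λ _ _ → z≤n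
least-witness P P? zero    pk | no ¬p0 = contradiction pk ¬p0
least-witness P P? (suc k) pk | no ¬p0 with least-witness (P ∘ suc) (P? ∘ suc) k pk
... | m , pm , least = suc m , pm , λ where
  zero    p0 → contradiction p0 ¬p0
  (suc i) pi → s≤s (least i pi)

x∈p⇒0<∣p∣ : ∀ {m} {x : Fin m} {p : Subset m} → x ∈ p → 0 < ∣ p ∣
x∈p⇒0<∣p∣ {x = x} {p} x∈p =
  subst (_≤ ∣ p ∣) (∣⁅x⁆∣≡1 x)
    (p⊆q⇒∣p∣≤∣q∣ λ y∈⁅x⁆ → subst (_∈ p) (sym (x∈⁅y⁆⇒x≡y x y∈⁅x⁆)) x∈p)

distinct-members⇒1<∣p∣ : ∀ {m} {x y : Fin m} {p : Subset m} → x ∈ p → y ∈ p → x ≢ y → 1 < ∣ p ∣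
distinct-members⇒1<∣p∣ x∈p y∈p x≢y =
  ≤-trans (s≤s (x∈p⇒0<∣p∣ (x∈p∧x≢y⇒x∈p-y y∈p (x≢y ∘ sym)))) (x∈p⇒∣p-x∣<∣p∣ x∈p)

injection⇒∣p∣≤∣q∣ : ∀ {m m′} (f : Fin m → Fin m′) (p : Subset m) {q : Subset m′} →
                    (∀ {a} → a ∈ p → f a ∈ q) →
                    (∀ {a b} → a ∈ p → b ∈ p → f a ≡ f b → a ≡ b) → ∣ p ∣ ≤ ∣ q ∣
injection⇒∣p∣≤∣q∣ f [] maps inj = z≤n
injection⇒∣p∣≤∣q∣ f (outside ∷ p) maps inj =
  injection⇒∣p∣≤∣q∣ (f ∘ suc) p (maps ∘ there)
    λ a∈p b∈p e → Finₚ.suc-injective (inj (there a∈p) (there b∈p) e)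
injection⇒∣p∣≤∣q∣ f (inside ∷ p) {q} maps inj =
  ≤-trans (s≤s (injection⇒∣p∣≤∣q∣ (f ∘ suc) p {q - f zero} maps′ inj′)) (x∈p⇒∣p-x∣<∣p∣ (maps here))
  where
  maps′ : ∀ {a} → a ∈ p → f (suc a) ∈ q - f zero
  maps′ a∈p = x∈p∧x≢y⇒x∈p-y (maps (there a∈p)) λ e → Finₚ.0≢1+n (inj here (there a∈p) (sym e))
  inj′ : ∀ {a b} → a ∈ p → b ∈ p → f (suc a) ≡ f (suc b) → a ≡ b
  inj′ a∈p b∈p e = Finₚ.suc-injective (inj (there a∈p) (there b∈p) e)

+a-+b≡+c-+d⇒a+d≡b+c : ∀ a b c d → + a ℤ.- + b ≡ + c ℤ.- + d → a + d ≡ b + c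
+a-+b≡+c-+d⇒a+d≡b+c a b c d e = ℤₚ.+-injective (begin
  + a ℤ.+ + d                           ≡⟨ regroupˡ (+ a) (+ b) (+ d) ⟩
  (+ a ℤ.- + b) ℤ.+ (+ b ℤ.+ + d)       ≡⟨ cong (ℤ._+ (+ b ℤ.+ + d)) e ⟩
  (+ c ℤ.- + d) ℤ.+ (+ b ℤ.+ + d)       ≡⟨ regroupʳ (+ b) (+ c) (+ d) ⟩
  + b ℤ.+ + c                           ∎)
  where
  open ≡-Reasoning
  regroupˡ : ∀ p q r → p ℤ.+ r ≡ (p ℤ.- q) ℤ.+ (q ℤ.+ r)
  regroupˡ = solve-∀
  regroupʳ : ∀ p q r → (q ℤ.- r) ℤ.+ (p ℤ.+ r) ≡ p ℤ.+ q
  regroupʳ = solve-∀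

∈tabulate⁺ : ∀ {m} {f : Fin m → Bool} {x} → f x ≡ true → x ∈ tabulate f
∈tabulate⁺ {f = f} {x} fx = lookup⇒[]= x (tabulate f) (trans (lookup∘tabulate f x) fx)

∈tabulate⁻ : ∀ {m} {f : Fin m → Bool} {x} → x ∈ tabulate f → f x ≡ true
∈tabulate⁻ {f = f} {x} x∈ = trans (sym (lookup∘tabulate f x)) ([]=⇒lookup x∈)

_++_ : ∀ {n} {G : Graph n} {u v w k l} → Walk G u v k → Walk G v w l → Walk G u w (k + l)
nil      ++ q = q
cons e p ++ q = cons e (p ++ q)

module _ {n : ℕ} (G : Graph n) where

  Edge? : ∀ u v → Dec (Edge G u v)
  Edge? u v = adj G u v ≟ᵇ true

  Edge-sym : ∀ {u v} → Edge G u v → Edge G v u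
  Edge-sym {u} {v} e = trans (sym (adj-sym G u v)) e

  Edge⇒≢ : ∀ {u v} → Edge G u v → u ≢ v
  Edge⇒≢ {u} e refl with trans (sym e) (irrefl G u)
  ... | ()

  Edge⇒∈nbhd : ∀ {v a} → Edge G v a → a ∈ nbhd G v
  Edge⇒∈nbhd {v} = ∈tabulate⁺ {f = adj G v}

  ∈nbhd⇒Edge : ∀ {v a} → a ∈ nbhd G v → Edge G v a
  ∈nbhd⇒Edge {v} = ∈tabulate⁻ {f = adj G v}

  Leaf : Fin n → Set
  Leaf v = deg G v ≡ 1

  leaf-neighbour-unique : ∀ {v a b} → Leaf v → Edge G v a → Edge G v b → a ≡ b
  leaf-neighbour-unique {a = a} {b} leaf va vb with a ≟ b
  ... | yes a≡b = a≡b
  ... | no a≢b with subst (1 <_) leaf (distinct-members⇒1<∣p∣ (Edge⇒∈nbhd va) (Edge⇒∈nbhd vb) a≢b)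
  ...   | s≤s ()

  nonleaf-other-neighbour : ∀ {v a} → ¬ Leaf v → Edge G v a → ∃ λ b → Edge G v b × b ≢ a
  nonleaf-other-neighbour {v} {a} ¬leaf va with Finₚ.any? (λ b → Edge? v b ×-dec ¬? (b ≟ a))
  ... | yes other = other
  ... | no ∄ = contradiction (≤-antisym deg≤1 (x∈p⇒0<∣p∣ (Edge⇒∈nbhd va))) ¬leaf
    where
    nbhd⊆⁅a⁆ : ∀ {b} → b ∈ nbhd G v → b ∈ ⁅ a ⁆
    nbhd⊆⁅a⁆ {b} b∈ with b ≟ a
    ... | yes refl = x∈⁅x⁆ a
    ... | no b≢a = contradiction (b , ∈nbhd⇒Edge b∈ , b≢a) ∄
    deg≤1 : deg G v ≤ 1
    deg≤1 = subst (deg G v ≤_) (∣⁅x⁆∣≡1 a) (p⊆q⇒∣p∣≤∣q∣ nbhd⊆⁅a⁆)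

  snoc : ∀ {u v w k} → Walk G u v k → Edge G v w → Walk G u w (suc k)
  snoc nil        e = cons e nil
  snoc (cons d p) e = cons d (snoc p e)

  reverse : ∀ {u v k} → Walk G u v k → Walk G v u k
  reverse nil        = nil
  reverse (cons e p) = snoc (reverse p) (Edge-sym e)

  walk? : ∀ k u v → Dec (Walk G u v k)
  walk? zero u v with u ≟ v
  ... | yes refl = yes nil
  ... | no u≢v = no λ { nil → u≢v refl }
  walk? (suc k) u v with Finₚ.any? (λ w → Edge? u w ×-dec walk? k w v)
  ... | yes (w , e , p) = yes (cons e p)
  ... | no ∄ = no λ { (cons e p) → ∄ (_ , e , p) }

  Dist-functional : ∀ {u v a b} → Dist G u v a → Dist G u v b → a ≡ b
  Dist-functional (pa , min-a) (pb , min-b) = ≤-antisym (min-a _ pb) (min-b _ pa)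

  adjacent-pair-covering⇒≅P2 : ∀ {x y} → Edge G x y → (∀ z → z ≡ x ⊎ z ≡ y) → Iso G P2
  adjacent-pair-covering⇒≅P2 {x} {y} xy cover = f , g , g∘f , f∘g , adj-preserved
    where
    side : ∀ {z} → z ≡ x ⊎ z ≡ y → Fin 2
    side (inj₁ _) = zero
    side (inj₂ _) = suc zero
    f : Fin n → Fin 2
    f z = side (cover z)
    g : Fin 2 → Fin n
    g zero       = x
    g (suc zero) = y
    g∘side : ∀ {z} (c : z ≡ x ⊎ z ≡ y) → g (side c) ≡ z
    g∘side (inj₁ z≡x) = sym z≡x
    g∘side (inj₂ z≡y) = sym z≡y
    g∘f : ∀ z → g (f z) ≡ z
    g∘f z = g∘side (cover z)
    side-x : (c : x ≡ x ⊎ x ≡ y) → side c ≡ zero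
    side-x (inj₁ _)   = refl
    side-x (inj₂ x≡y) = contradiction x≡y (Edge⇒≢ xy)
    side-y : (c : y ≡ x ⊎ y ≡ y) → side c ≡ suc zero
    side-y (inj₁ y≡x) = contradiction (sym y≡x) (Edge⇒≢ xy)
    side-y (inj₂ _)   = refl
    f∘g : ∀ i → f (g i) ≡ i
    f∘g zero       = side-x (cover x)
    f∘g (suc zero) = side-y (cover y)
    adj-side : ∀ {u v} (c : u ≡ x ⊎ u ≡ y) (d : v ≡ x ⊎ v ≡ y) → adj G u v ≡ adj P2 (side c) (side d)
    adj-side (inj₁ refl) (inj₁ refl) = irrefl G x
    adj-side (inj₁ refl) (inj₂ refl) = xy
    adj-side (inj₂ refl) (inj₁ refl) = Edge-sym xy
    adj-side (inj₂ refl) (inj₂ refl) = irrefl G y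
    adj-preserved : ∀ u v → adj G u v ≡ adj P2 (f u) (f v)
    adj-preserved u v = adj-side (cover u) (cover v)

  doublyResolving⇒1<∣T∣ : ∀ {x y} → x ≢ y → ∀ T → DoublyResolving G (_∈ T) → 1 < ∣ T ∣
  doublyResolving⇒1<∣T∣ x≢y T doubly with doubly _ _ x≢y
  ... | u , v , u∈T , v∈T , _ , _ , _ , _ , ux , uy , vx , vy , differ with u ≟ v
  ... | yes refl = contradiction
        (cong₂ ℤ._-_ (cong +_ (Dist-functional ux vx)) (cong +_ (Dist-functional uy vy))) differ
  ... | no u≢v = distinct-members⇒1<∣p∣ u∈T v∈T u≢v

  module _ (girth : GirthAtLeast5 G) where

    no-triangle : ∀ {a b c} → Edge G a b → Edge G b c → Edge G c a → ⊥
    no-triangle {a} {b} {c} ab bc ca with girth 2 cycle (s≤s (s≤s (s≤s z≤n)) , injective , path , ca)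
      where
      cycle : Fin 3 → Fin n
      cycle zero             = a
      cycle (suc zero)       = b
      cycle (suc (suc zero)) = c
      path : ∀ (i : Fin 2) → Edge G (cycle (inject₁ i)) (cycle (suc i))
      path zero       = ab
      path (suc zero) = bc
      injective : ∀ i j → cycle i ≡ cycle j → i ≡ j
      injective zero             zero             _ = refl
      injective zero             (suc zero)       e = contradiction e (Edge⇒≢ ab)
      injective zero             (suc (suc zero)) e = contradiction (sym e) (Edge⇒≢ ca)
      injective (suc zero)       zero             e = contradiction (sym e) (Edge⇒≢ ab)
      injective (suc zero)       (suc zero)       _ = refl
      injective (suc zero)       (suc (suc zero)) e = contradiction e (Edge⇒≢ bc)
      injective (suc (suc zero)) zero             e = contradiction e (Edge⇒≢ ca)
      injective (suc (suc zero)) (suc zero)       e = contradiction (sym e) (Edge⇒≢ bc)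
      injective (suc (suc zero)) (suc (suc zero)) _ = refl
    ... | s≤s (s≤s (s≤s ()))

    no-4-cycle : ∀ {a b c d} → Edge G a b → Edge G b c → Edge G c d → Edge G d a →
                 a ≢ c → b ≢ d → ⊥
    no-4-cycle {a} {b} {c} {d} ab bc cd da a≢c b≢d
      with girth 3 cycle (s≤s (s≤s (s≤s z≤n)) , injective , path , da)
      where
      cycle : Fin 4 → Fin n
      cycle zero                   = a
      cycle (suc zero)             = b
      cycle (suc (suc zero))       = c
      cycle (suc (suc (suc zero))) = d
      path : ∀ (i : Fin 3) → Edge G (cycle (inject₁ i)) (cycle (suc i))
      path zero             = ab
      path (suc zero)       = bc
      path (suc (suc zero)) = cd
      injective : ∀ i j → cycle i ≡ cycle j → i ≡ j
      injective zero                   zero                   _ = refl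
      injective zero                   (suc zero)             e = contradiction e (Edge⇒≢ ab)
      injective zero                   (suc (suc zero))       e = contradiction e a≢c
      injective zero                   (suc (suc (suc zero))) e = contradiction (sym e) (Edge⇒≢ da)
      injective (suc zero)             zero                   e = contradiction (sym e) (Edge⇒≢ ab)
      injective (suc zero)             (suc zero)             _ = refl
      injective (suc zero)             (suc (suc zero))       e = contradiction e (Edge⇒≢ bc)
      injective (suc zero)             (suc (suc (suc zero))) e = contradiction e b≢d
      injective (suc (suc zero))       zero                   e = contradiction (sym e) a≢c
      injective (suc (suc zero))       (suc zero)             e = contradiction (sym e) (Edge⇒≢ bc)
      injective (suc (suc zero))       (suc (suc zero))       _ = refl
      injective (suc (suc zero))       (suc (suc (suc zero))) e = contradiction e (Edge⇒≢ cd)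
      injective (suc (suc (suc zero))) zero                   e = contradiction e (Edge⇒≢ da)
      injective (suc (suc (suc zero))) (suc zero)             e = contradiction (sym e) b≢d
      injective (suc (suc (suc zero))) (suc (suc zero))       e = contradiction (sym e) (Edge⇒≢ cd)
      injective (suc (suc (suc zero))) (suc (suc (suc zero))) _ = refl
    ... | s≤s (s≤s (s≤s (s≤s ())))

  module _ (S : Subset n) where

    bar : ∀ u → ∃ (BarOf G S u)
    bar u with Finₚ.any? (λ z → Edge? u z ×-dec ¬? (z ∈? S) ×-dec deg G z ℕ.≟ 1)
    ... | yes (z , pendant) = z , inj₁ pendant
    ... | no ∄ = u , inj₂ (refl , λ z uz z∉S leaf → ∄ (z , uz , z∉S , leaf))

    BarOf? : ∀ u w → Dec (BarOf G S u w)
    BarOf? u w = (Edge? u w ×-dec ¬? (w ∈? S) ×-dec deg G w ℕ.≟ 1)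
           ⊎-dec (w ≟ u ×-dec Finₚ.all? λ z → Edge? u z →-dec ¬? (z ∈? S) →-dec ¬? (deg G z ℕ.≟ 1))

    SBar? : ∀ w → Dec (SBar G S w)
    SBar? w = Finₚ.any? λ u → u ∈? S ×-dec BarOf? u w

    barSet : Subset n
    barSet = tabulate (isYes ∘ SBar?)

    SBar⇒∈barSet : ∀ {w} → SBar G S w → w ∈ barSet
    SBar⇒∈barSet {w} w̄ =
      ∈tabulate⁺ {f = isYes ∘ SBar?} (Equivalence.to T-≡ (fromWitness {a? = SBar? w} w̄))

    ∈barSet⇒SBar : ∀ {w} → w ∈ barSet → SBar G S w
    ∈barSet⇒SBar {w} w∈ =
      toWitness {a? = SBar? w} (Equivalence.from T-≡ (∈tabulate⁻ {f = isYes ∘ SBar?} w∈))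

    bar≢member : ∀ {s r v} → BarOf G S s r → s ≢ v → v ∈ S → r ≢ v
    bar≢member (inj₁ (_ , r∉S , _)) _   v∈S refl = r∉S v∈S
    bar≢member (inj₂ (refl , _))    s≢v _   = s≢v

    bar≢nonleaf : ∀ {s r v} → BarOf G S s r → s ≢ v → ¬ Leaf v → r ≢ v
    bar≢nonleaf (inj₁ (_ , _ , leaf)) _   ¬leaf refl = ¬leaf leaf
    bar≢nonleaf (inj₂ (refl , _))     s≢v _          = s≢v

  module _ (conn : Connected G) where

    private
      shortest : ∀ u v → ∃ (Dist G u v)
      shortest u v = least-witness (λ k → Walk G u v k) (λ k → walk? k u v) _ (proj₂ (conn u v))

    dist : Fin n → Fin n → ℕ
    dist u v = proj₁ (shortest u v)

    dist-Dist : ∀ u v → Dist G u v (dist u v)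
    dist-Dist u v = proj₂ (shortest u v)

    dist-walk : ∀ u v → Walk G u v (dist u v)
    dist-walk u v = proj₁ (dist-Dist u v)

    dist-minimal : ∀ {u v k} → Walk G u v k → dist u v ≤ k
    dist-minimal {u} {v} p = proj₂ (dist-Dist u v) _ p

    Dist⇒≡dist : ∀ {u v k} → Dist G u v k → k ≡ dist u v
    Dist⇒≡dist {u} {v} d = Dist-functional d (dist-Dist u v)

    dist-sym : ∀ u v → dist u v ≡ dist v u
    dist-sym u v =
      ≤-antisym (dist-minimal (reverse (dist-walk v u))) (dist-minimal (reverse (dist-walk u v)))

    dist-refl : ∀ u → dist u u ≡ 0
    dist-refl u = n≤0⇒n≡0 (dist-minimal {u} nil)

    dist<1⇒≡ : ∀ {u v} → dist u v < 1 → u ≡ v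
    dist<1⇒≡ {u} {v} d<1 with subst (Walk G u v) (n<1⇒n≡0 d<1) (dist-walk u v)
    ... | nil = refl

    dist≡0⇒≡ : ∀ {u v} → dist u v ≡ 0 → u ≡ v
    dist≡0⇒≡ = dist<1⇒≡ ∘ s≤s ∘ ≤-reflexive

    dist≡1⇒Edge : ∀ {u v} → dist u v ≡ 1 → Edge G u v
    dist≡1⇒Edge {u} {v} d≡1 with subst (Walk G u v) d≡1 (dist-walk u v)
    ... | cons e nil = e

    Edge⇒dist≡1 : ∀ {u v} → Edge G u v → dist u v ≡ 1
    Edge⇒dist≡1 e = ≤-antisym (dist-minimal (cons e nil))
                              (n≢0⇒n>0 (Edge⇒≢ e ∘ dist≡0⇒≡))

    dist-step : ∀ {u v w} → Edge G v w → dist u w ≤ suc (dist u v)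
    dist-step {u} {v} e = dist-minimal (snoc (dist-walk u v) e)

    dist-from-leaf : ∀ {r s z} → Leaf r → Edge G r s → r ≢ z → dist r z ≡ suc (dist s z)
    dist-from-leaf {r} {s} {z} leaf rs r≢z =
      ≤-antisym (dist-minimal (cons rs (dist-walk s z))) (via-s (dist-walk r z))
      where
      via-s : ∀ {k} → Walk G r z k → suc (dist s z) ≤ k
      via-s nil         = contradiction refl r≢z
      via-s (cons rt p) =
        s≤s (dist-minimal (subst (λ t → Walk G t z _) (leaf-neighbour-unique leaf rt rs) p))

    dist-to-leaf : ∀ {r s z} → Leaf r → Edge G r s → z ≢ r → dist z r ≡ suc (dist z s)
    dist-to-leaf {r} {s} {z} leaf rs z≢r =
      trans (dist-sym z r) (trans (dist-from-leaf leaf rs (z≢r ∘ sym)) (cong suc (dist-sym s z)))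

    module _ {S : Subset n} (resolving : Resolving G (_∈ S)) where

      separated-by-S : ∀ {x y} → x ≢ y → ∃ λ s → s ∈ S × dist s x ≢ dist s y
      separated-by-S {x} {y} x≢y with resolving x y x≢y
      ... | s , s∈S , _ , _ , sx , sy , differ =
            s , s∈S , λ e → differ (trans (Dist⇒≡dist sx) (trans e (sym (Dist⇒≡dist sy))))

      separated-by-barSet : ∀ {x y} → x ≢ y → ∃ λ q → SBar G S q × dist q x ≢ dist q y
      separated-by-barSet {x} {y} x≢y with separated-by-S x≢y
      ... | s , s∈S , differ with bar S s
      ... | .s , b@(inj₂ (refl , _)) = s , (s , s∈S , b) , differ
      ... | r , b@(inj₁ (sr , _ , leaf)) with r ≟ x | r ≟ y
      ...   | yes refl | _        = r , (s , s∈S , b) , λ e → x≢y (dist≡0⇒≡ (trans (sym e) (dist-refl r)))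
      ...   | no _     | yes refl = r , (s , s∈S , b) , λ e → x≢y (sym (dist≡0⇒≡ (trans e (dist-refl r))))
      ...   | no r≢x   | no r≢y   = r , (s , s∈S , b) , λ e → differ (suc-injective (begin
              suc (dist s x) ≡⟨ dist-from-leaf leaf (Edge-sym sr) r≢x ⟨
              dist r x       ≡⟨ e ⟩
              dist r y       ≡⟨ dist-from-leaf leaf (Edge-sym sr) r≢y ⟩
              suc (dist s y) ∎))
        where open ≡-Reasoning

      bar-unique : ∀ {u a b} → BarOf G S u a → BarOf G S u b → a ≡ b
      bar-unique (inj₂ (refl , _))      (inj₂ (refl , _))      = refl
      bar-unique (inj₁ (ua , a∉S , la)) (inj₂ (_ , none))      = contradiction la (none _ ua a∉S)
      bar-unique (inj₂ (_ , none))      (inj₁ (ub , b∉S , lb)) = contradiction lb (none _ ub b∉S)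
      bar-unique {u} {a} {b} (inj₁ (ua , a∉S , la)) (inj₁ (ub , b∉S , lb)) with a ≟ b
      ... | yes a≡b = a≡b
      ... | no a≢b with separated-by-S a≢b
      ...   | s , s∈S , differ = contradiction (begin
              dist s a       ≡⟨ dist-to-leaf la (Edge-sym ua) (outside-S a∉S) ⟩
              suc (dist s u) ≡⟨ dist-to-leaf lb (Edge-sym ub) (outside-S b∉S) ⟨
              dist s b       ∎) differ
        where
        open ≡-Reasoning
        outside-S : ∀ {v} → v ∉ S → s ≢ v
        outside-S v∉S refl = v∉S s∈S

      -- A left inverse of u ↦ ū on S̄: a pendant vertex outside S goes to its only neighbour.
      parent : Fin n → Fin n
      parent w with w ∈? S
      ... | yes _ = w
      ... | no _ with Finₚ.any? (Edge? w)
      ...   | yes (u , _) = u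
      ...   | no _        = w

      parent-bar : ∀ {u w} → u ∈ S → BarOf G S u w → parent w ≡ u
      parent-bar {w = w} u∈S b with w ∈? S
      parent-bar u∈S (inj₂ (refl , _))     | yes _   = refl
      parent-bar u∈S (inj₁ (_ , w∉S , _))  | yes w∈S = contradiction w∈S w∉S
      parent-bar u∈S (inj₂ (refl , _))     | no w∉S  = contradiction u∈S w∉S
      parent-bar {u} {w} u∈S (inj₁ (uw , _ , leaf)) | no _ with Finₚ.any? (Edge? w)
      ... | yes (v , wv) = leaf-neighbour-unique leaf wv (Edge-sym uw)
      ... | no ∄         = contradiction (u , Edge-sym uw) ∄

      ∣barSet∣≤∣S∣ : ∣ barSet S ∣ ≤ ∣ S ∣
      ∣barSet∣≤∣S∣ = injection⇒∣p∣≤∣q∣ parent (barSet S) maps injective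
        where
        maps : ∀ {w} → w ∈ barSet S → parent w ∈ S
        maps w∈ with ∈barSet⇒SBar S w∈
        ... | u , u∈S , b = subst (_∈ S) (sym (parent-bar u∈S b)) u∈S
        injective : ∀ {a b} → a ∈ barSet S → b ∈ barSet S → parent a ≡ parent b → a ≡ b
        injective a∈ b∈ e with ∈barSet⇒SBar S a∈ | ∈barSet⇒SBar S b∈
        ... | u , u∈S , ba | v , v∈S , bb = bar-unique ba (subst (λ t → BarOf G S t _) v≡u bb)
          where
          v≡u : v ≡ u
          v≡u = trans (sym (parent-bar v∈S bb)) (trans (sym e) (parent-bar u∈S ba))

    doublyResolves : ∀ {u v x y} → dist u x + dist v y ≢ dist u y + dist v x → DoublyResolves G u v x y
    doublyResolves {u} {v} {x} {y} differ =
      _ , _ , _ , _ , dist-Dist u x , dist-Dist u y , dist-Dist v x , dist-Dist v y ,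
      differ ∘ +a-+b≡+c-+d⇒a+d≡b+c (dist u x) (dist u y) (dist v x) (dist v y)

    module _ (girth : GirthAtLeast5 G) (≇P2 : ¬ Iso G P2) where
      module _ {S : Subset n} (resolving : Resolving G (_∈ S)) (dominating : Dominating G (_∈ S)) where

        Nearer : Fin n → Fin n → Set
        Nearer y x = ∀ s → SBar G S s → dist s y < dist s x

        nearer-via-bar : ∀ {x y s r} → Nearer y x → s ∈ S → BarOf G S s r → r ≢ x → r ≢ y →
                         dist s y < dist s x
        nearer-via-bar near s∈S b@(inj₂ (refl , _)) _ _ = near _ (_ , s∈S , b)
        nearer-via-bar near s∈S b@(inj₁ (sr , _ , leaf)) r≢x r≢y =
          ≤-pred (subst₂ _<_ (dist-from-leaf leaf (Edge-sym sr) r≢y)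
                             (dist-from-leaf leaf (Edge-sym sr) r≢x)
                             (near _ (_ , s∈S , b)))

        nearer-neighbour : ∀ {x y s} → Nearer y x → s ∈ S → Edge G s x → ¬ Leaf x →
                           s ≡ y ⊎ (Edge G s y × y ∉ S × Leaf y)
        nearer-neighbour {x} {y} {s} near s∈S sx ¬leaf with bar S s
        ... | r , b with r ≟ y
        nearer-neighbour near s∈S sx ¬leaf | _ , inj₂ (refl , _) | yes refl = inj₁ refl
        nearer-neighbour near s∈S sx ¬leaf | _ , inj₁ pendant    | yes refl = inj₂ pendant
        nearer-neighbour {x} {y} {s} near s∈S sx ¬leaf | r , b | no r≢y =
          inj₁ (dist<1⇒≡ (subst (dist s y <_) (Edge⇒dist≡1 sx)
                 (nearer-via-bar near s∈S b (bar≢nonleaf S b (Edge⇒≢ sx) ¬leaf) r≢y)))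

        -- The hypothesis on x holds when x = u or x is adjacent to u.
        SBar⊆pendant : ∀ {x y u} → Nearer y x → Leaf y → Edge G y u →
                       (∀ r → dist r x ≤ suc (dist r u)) → ∀ {r} → SBar G S r → r ≡ y
        SBar⊆pendant {x} {y} near leaf yu x-near-u {r} r̄ with r ≟ y
        ... | yes r≡y = r≡y
        ... | no r≢y = contradiction
              (≤-trans (near r r̄) (subst (dist r x ≤_) (sym (dist-to-leaf leaf yu r≢y)) (x-near-u r)))
              (n≮n _)

        S⊆pendant-neighbour : ∀ {x y u} → Nearer y x → y ∉ S → Leaf y → Edge G u y →
                              (∀ r → dist r x ≤ suc (dist r u)) → ∀ {s} → s ∈ S → s ≡ u
        S⊆pendant-neighbour near y∉S leaf uy x-near-u {s} s∈S with bar S s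
        ... | r , b with SBar⊆pendant near leaf (Edge-sym uy) x-near-u (s , s∈S , b)
        ... | refl with b
        ...   | inj₁ (sy , _ , _) = leaf-neighbour-unique leaf (Edge-sym sy) (Edge-sym uy)
        ...   | inj₂ (refl , _)   = contradiction s∈S y∉S

        S⊆⁅u⁆⇒dist-injective : ∀ {u a b} → (∀ {s} → s ∈ S → s ≡ u) → dist u a ≡ dist u b → a ≡ b
        S⊆⁅u⁆⇒dist-injective {a = a} {b} S⊆⁅u⁆ e with a ≟ b
        ... | yes a≡b = a≡b
        ... | no a≢b with separated-by-S resolving a≢b
        ...   | s , s∈S , differ with S⊆⁅u⁆ s∈S
        ...     | refl = contradiction e differ

        -- x̄ is nearer to y than x is, so y = x̄ is pendant at x; then S = {x}, and domination
        -- together with resolution leaves no vertex besides x and y.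
        member-not-nearer : ∀ {x y} → x ∈ S → ¬ Nearer y x
        member-not-nearer {x} {y} x∈S near with bar S x
        ... | _ , b@(inj₂ (refl , _)) = n≮0 (subst (dist x y <_) (dist-refl x) (near x (x , x∈S , b)))
        ... | w , b@(inj₁ (xw , w∉S , leaf))
          with dist<1⇒≡ {w} {y} (subst (dist w y <_) (Edge⇒dist≡1 (Edge-sym xw)) (near w (x , x∈S , b)))
        ...   | refl = ≇P2 (adjacent-pair-covering⇒≅P2 xw cover)
          where
          S⊆⁅x⁆ : ∀ {s} → s ∈ S → s ≡ x
          S⊆⁅x⁆ = S⊆pendant-neighbour near w∉S leaf xw (λ r → n≤1+n _)
          cover : ∀ z → z ≡ x ⊎ z ≡ w
          cover z with z ≟ x | z ≟ w
          ... | yes z≡x | _       = inj₁ z≡x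
          ... | no _    | yes z≡w = inj₂ z≡w
          ... | no z≢x  | no z≢w  with dominating z (z≢x ∘ S⊆⁅x⁆)
          ...   | u , u∈S , zu = contradiction
                  (S⊆⁅u⁆⇒dist-injective S⊆⁅x⁆ (trans (Edge⇒dist≡1 (Edge-sym zx)) (sym (Edge⇒dist≡1 xw))))
                  z≢w
            where
            zx : Edge G z x
            zx = subst (Edge G z) (S⊆⁅x⁆ u∈S) zu

        S-neighbour-not-nearer : ∀ {x y} → y ∈ S → Edge G x y → x ∉ S → ¬ Leaf x → ¬ Nearer y x
        S-neighbour-not-nearer {x} {y} y∈S xy x∉S ¬leaf near with nonleaf-other-neighbour ¬leaf xy
        ... | z , xz , z≢y with z ∈? S
        ... | yes z∈S =
          [ z≢y , (λ (_ , y∉S , _) → y∉S y∈S) ]′ (nearer-neighbour near z∈S (Edge-sym xz) ¬leaf)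
        ... | no z∉S with dominating z z∉S
        ... | t , t∈S , zt with t ≟ y
        ... | yes refl = no-triangle girth xz zt (Edge-sym xy)
        ... | no t≢y = no-4-cycle girth xz zt (dist≡1⇒Edge ty≡1) (Edge-sym xy) x≢t z≢y
          where
          x≢t : x ≢ t
          x≢t refl = x∉S t∈S
          t-nearer : dist t y < dist t x
          t-nearer = let _ , b = bar S t in
            nearer-via-bar near t∈S b (bar≢nonleaf S b (x≢t ∘ sym) ¬leaf) (bar≢member S b t≢y y∈S)
          t-z-x : Walk G t x 2
          t-z-x = cons (Edge-sym zt) (cons (Edge-sym xz) nil)
          ty≡1 : dist t y ≡ 1
          ty≡1 = ≤-antisym (m<1+n⇒m≤n (≤-trans t-nearer (dist-minimal t-z-x)))
                           (n≢0⇒n>0 (t≢y ∘ dist≡0⇒≡))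

        nonmember-not-nearer : ∀ {x y} → x ∉ S → ¬ Nearer y x
        nonmember-not-nearer {x} {y} x∉S near with dominating x x∉S
        ... | u , u∈S , xu with deg G x ℕ.≟ 1
        ... | yes leaf =
          n≮0 (subst (dist x y <_) (dist-refl x) (near x (u , u∈S , inj₁ (Edge-sym xu , x∉S , leaf))))
        ... | no ¬leaf with nearer-neighbour near u∈S (Edge-sym xu) ¬leaf
        ... | inj₁ refl = S-neighbour-not-nearer u∈S xu x∉S ¬leaf near
        ... | inj₂ (uy , y∉S , y-leaf) = ¬leaf (subst Leaf (sym x≡y) y-leaf)
          where
          x≡y : x ≡ y
          x≡y = S⊆⁅u⁆⇒dist-injective
                  (S⊆pendant-neighbour near y∉S y-leaf uy (λ r → dist-step {r} (Edge-sym xu)))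
                  (trans (Edge⇒dist≡1 (Edge-sym xu)) (sym (Edge⇒dist≡1 uy)))

        not-nearer : ∀ {x y} → ¬ Nearer y x
        not-nearer {x} with x ∈? S
        ... | yes x∈S = member-not-nearer x∈S
        ... | no x∉S  = nonmember-not-nearer x∉S

        not-all-nearer : ∀ x y → ∃ λ s → SBar G S s × dist s x ≤ dist s y
        not-all-nearer x y with Finₚ.any? (λ s → SBar? S s ×-dec dist s x ≤? dist s y)
        ... | yes witness = witness
        ... | no ∄ = contradiction (λ s s̄ → ≰⇒> λ le → ∄ (s , s̄ , le)) not-nearer

        SBar-doublyResolving : DoublyResolving G (SBar G S)
        SBar-doublyResolving x y x≢y with separated-by-barSet resolving x≢y
        ... | q , q̄ , differ with <-cmp (dist q x) (dist q y)
        ... | tri≈ _ e _ = contradiction e differ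
        ... | tri< qx<qy _ _ = let s , s̄ , sy≤sx = not-all-nearer y x in
              q , s , q̄ , s̄ , doublyResolves (<⇒≢ (+-mono-<-≤ qx<qy sy≤sx))
        ... | tri> _ _ qy<qx = let s , s̄ , sx≤sy = not-all-nearer x y in
              q , s , q̄ , s̄ , doublyResolves (≢-sym (<⇒≢ (+-mono-<-≤ qy<qx sx≤sy)))

      mld⇒smaller-doublyResolving : ∀ {S} → MetricLocatingDominating G (_∈ S) →
                                    ∃ λ T → DoublyResolving G (_∈ T) × ∣ T ∣ ≤ ∣ S ∣
      mld⇒smaller-doublyResolving {S} (resolving , dominating) =
        barSet S , into-barSet , ∣barSet∣≤∣S∣ resolving
        where
        into-barSet : DoublyResolving G (_∈ barSet S)
        into-barSet x y x≢y with SBar-doublyResolving resolving dominating x y x≢y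
        ... | u , v , ū , v̄ , doubly = u , v , SBar⇒∈barSet S ū , SBar⇒∈barSet S v̄ , doubly

      ψ-bound⇒γM-bound : ∀ {k} → (∀ T → DoublyResolving G (_∈ T) → k ≤ ∣ T ∣) →
                         ∀ S → MetricLocatingDominating G (_∈ S) → k ≤ ∣ S ∣
      ψ-bound⇒γM-bound ψ-bound S mld =
        let T , doubly , ∣T∣≤∣S∣ = mld⇒smaller-doublyResolving mld
        in ≤-trans (ψ-bound T doubly) ∣T∣≤∣S∣

      ψ≤γM : ∀ {a b} → IsPsi G a → IsGammaM G b → a ≤ b
      ψ≤γM (_ , ψ-minimal) ((S , mld , ∣S∣≡b) , _) =
        subst (_ ≤_) ∣S∣≡b (ψ-bound⇒γM-bound ψ-minimal S mld)

      mld-attaining-ψ-bound⇒ψ≡γM : ∀ {k S} → MetricLocatingDominating G (_∈ S) → ∣ S ∣ ≡ k →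
                                   (∀ T → DoublyResolving G (_∈ T) → k ≤ ∣ T ∣) →
                                   IsPsi G k × IsGammaM G k
      mld-attaining-ψ-bound⇒ψ≡γM {S = S} mld ∣S∣≡k ψ-bound =
        let T , doubly , ∣T∣≤∣S∣ = mld⇒smaller-doublyResolving mld
        in ((T , doubly , ≤-antisym (subst (∣ T ∣ ≤_) ∣S∣≡k ∣T∣≤∣S∣) (ψ-bound T doubly)) , ψ-bound) ,
           ((S , mld , ∣S∣≡k) , ψ-bound⇒γM-bound ψ-bound)


P₃ : Graph 3
P₃ = record { adj = differ-by-one ; adj-sym = symmetric ; irrefl = irreflexive }
  where
  differ-by-one : Fin 3 → Fin 3 → Bool
  differ-by-one i j = (suc (toℕ i) ℕ.≡ᵇ toℕ j) ∨ (suc (toℕ j) ℕ.≡ᵇ toℕ i)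
  symmetric : ∀ i j → differ-by-one i j ≡ differ-by-one j i
  symmetric i j = ∨-comm (suc (toℕ i) ℕ.≡ᵇ toℕ j) (suc (toℕ j) ℕ.≡ᵇ toℕ i)
  irreflexive : ∀ i → differ-by-one i i ≡ false
  irreflexive zero             = refl
  irreflexive (suc zero)       = refl
  irreflexive (suc (suc zero)) = refl

P₃-connected : Connected P₃
P₃-connected u v = let k , p = from-centre u ; l , q = from-centre v in k + l , reverse P₃ p ++ q
  where
  from-centre : ∀ v → ∃ (Walk P₃ (suc zero) v)
  from-centre zero             = 1 , cons refl nil
  from-centre (suc zero)       = 0 , nil
  from-centre (suc (suc zero)) = 1 , cons refl nil

P₃-girth : GirthAtLeast5 P₃
P₃-girth zero                f (s≤s () , _)
P₃-girth (suc zero)          f (s≤s (s≤s ()) , _)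
P₃-girth (suc (suc zero))    f (_ , _ , path , closing) =
  ⊥-elim (triangle-free _ _ (f (suc (suc zero))) (path zero , path (suc zero) , closing))
  where
  triangle-free : ∀ a b c → ¬ (Edge P₃ a b × Edge P₃ b c × Edge P₃ c a)
  triangle-free = toWitness {a? = Finₚ.all? λ a → Finₚ.all? λ b → Finₚ.all? λ c →
                                  ¬? (Edge? P₃ a b ×-dec Edge? P₃ b c ×-dec Edge? P₃ c a)} _
P₃-girth (suc (suc (suc m))) f (_ , injective , _) with Finₚ.pigeonhole (s≤s (s≤s (s≤s (s≤s z≤n)))) f
... | i , j , i<j , fi≡fj = ⊥-elim (Finₚ.<-irrefl (injective i j fi≡fj) i<j)

P₃≇P2 : ¬ Iso P₃ P2
P₃≇P2 (f , g , g∘f , _) with Finₚ.pigeonhole (s≤s (s≤s (s≤s z≤n))) f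
... | i , j , i<j , fi≡fj = Finₚ.<-irrefl (trans (sym (g∘f i)) (trans (cong g fi≡fj) (g∘f j))) i<j

end-and-centre : Subset 3
end-and-centre = inside ∷ inside ∷ outside ∷ []

end-and-centre-mld : MetricLocatingDominating P₃ (_∈ end-and-centre)
end-and-centre-mld = resolving , dominating
  where
  dist-from-end-injective : ∀ x y → dist P₃ P₃-connected zero x ≡ dist P₃ P₃-connected zero y → x ≡ y
  dist-from-end-injective = toWitness {a? = Finₚ.all? λ x → Finₚ.all? λ y →
    dist P₃ P₃-connected zero x ℕ.≟ dist P₃ P₃-connected zero y →-dec x ≟ y} _
  resolving : Resolving P₃ (_∈ end-and-centre)
  resolving x y x≢y =
    zero , here , _ , _ , dist-Dist P₃ P₃-connected zero x , dist-Dist P₃ P₃-connected zero y ,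
    x≢y ∘ dist-from-end-injective x y
  dominating : Dominating P₃ (_∈ end-and-centre)
  dominating zero             ∉ = contradiction here ∉
  dominating (suc zero)       ∉ = contradiction (there here) ∉
  dominating (suc (suc zero)) _ = suc zero , there here , refl

proposition2 : ((n : ℕ) (G : Graph n) → IsGraph G → GirthAtLeast5 G → ¬ Iso G P2 →
      (∀ (S : Subset n) → MetricLocatingDominating G (_∈ S) →
         DoublyResolving G (SBar G S))
      × (∀ a b → IsPsi G a → IsGammaM G b → a ≤ b))
    × (∃ λ n → ∃ λ (G : Graph n) → IsGraph G × GirthAtLeast5 G ×
         ∃ λ k → IsPsi G k × IsGammaM G k)
proposition2 =
  (λ n G (_ , conn) girth ≇P2 →
    (λ S (resolving , dominating) → SBar-doublyResolving G conn girth ≇P2 resolving dominating) ,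
    λ _ _ → ψ≤γM G conn girth ≇P2) ,
  (3 , P₃ , (s≤s (s≤s z≤n) , P₃-connected) , P₃-girth , 2 ,
   mld-attaining-ψ-bound⇒ψ≡γM P₃ P₃-connected P₃-girth P₃≇P2 end-and-centre-mld refl
     (doublyResolving⇒1<∣T∣ P₃ {zero} {suc zero} (λ ())))
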